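{- Let $G$ be a connected graph with vertex set $\{1,\dots,n\}$, $n\ge 2$, let $\Phi=(F_1,\dots,F_n)$ be an $n$-tuple of pairwise disjoint graphs with $\delta(F_i)\ge 1$ for all $i$, and let $G[\Phi]$ be the generalized lexicographic product. Then $G[\Phi]$ is well $\gamma_t$-dominated if and only if $G$ is complete and, for all $i\in[n]$, $F_i$ is well $\gamma_t$-dominated with $\gamma_t(F_i)=2$. Moreover, if $G[\Phi]$ is well $\gamma_t$-dominated, then $\gamma_t(G[\Phi])=2$.
   Context: All graphs are finite, simple and undirected; $\delta(H)$ is the minimum degree. The generalized lexicographic product $G[\Phi]$ is the graph with vertex set $\bigcup_{i=1}^n V(F_i)$ in which each $F_i$ is an induced subgraph, and for $x\in V(F_i)$, $y\in V(F_j)$ with $i\neq j$, $xy$ is an edge iff $ij\in E(G)$. A total dominating set of $H$ is a set $S$ such that every vertex of $H$ has a neighbor in $S$; it is minimal if no proper subset is total dominating. $\gamma_t(H)$ is the minimum and $\Gamma_t(H)$ the maximum cardinality of a minimal total dominating set; $H$ is well $\gamma_t$-dominated if $\gamma_t(H)=\Gamma_t(H)$. -}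

module Defs where

open import Data.Nat using (ℕ; zero; suc; _+_; _≤_; _<_)
open import Data.Fin using (Fin; zero; suc; splitAt; _≟_)
open import Data.Fin.Subset using (Subset; _∈_; _⊂_; ∣_∣)
open import Data.Bool using (Bool; true; false)
open import Data.Product using (Σ; ∃; _×_; _,_; proj₁; proj₂)
open import Data.Sum using (inj₁; inj₂)
open import Relation.Nullary using (¬_; yes; no)
open import Relation.Binary.PropositionalEquality using (_≡_; _≢_; refl)

record Graph : Set where
  field
    size   : ℕ
    adj    : Fin size → Fin size → Bool
    adjSym : ∀ u v → adj u v ≡ adj v u
    irrefl : ∀ v → adj v v ≡ false
open Graph public

data Reach (G : Graph) : Fin (size G) → Fin (size G) → Set where
  here : ∀ {v} → Reach G v v
  step : ∀ {u v w} → adj G u v ≡ true → Reach G v w → Reach G u w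

Connected : Graph → Set
Connected G = ∀ u v → Reach G u v

Complete : Graph → Set
Complete G = ∀ u v → u ≢ v → adj G u v ≡ true

MinDegreeAtLeast1 : Graph → Set
MinDegreeAtLeast1 F = (0 < size F) × (∀ v → ∃ λ u → adj F v u ≡ true)

IsTotalDominating : (H : Graph) → Subset (size H) → Set
IsTotalDominating H S = ∀ v → ∃ λ u → u ∈ S × adj H v u ≡ true

IsMinimalTotalDominating : (H : Graph) → Subset (size H) → Set
IsMinimalTotalDominating H S =
  IsTotalDominating H S × (∀ T → T ⊂ S → ¬ IsTotalDominating H T)

IsGammaT : Graph → ℕ → Set
IsGammaT H k =
  (∃ λ S → IsMinimalTotalDominating H S × ∣ S ∣ ≡ k)
  × (∀ S → IsMinimalTotalDominating H S → k ≤ ∣ S ∣)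

IsUpperGammaT : Graph → ℕ → Set
IsUpperGammaT H k =
  (∃ λ S → IsMinimalTotalDominating H S × ∣ S ∣ ≡ k)
  × (∀ S → IsMinimalTotalDominating H S → ∣ S ∣ ≤ k)

WellTotalDominated : Graph → Set
WellTotalDominated H = ∃ λ k → IsGammaT H k × IsUpperGammaT H k

-- Generalized lexicographic product G[Φ].  The vertex set is the disjoint
-- union of the V(F_i), encoded as Fin (Σ_i |V(F_i)|) in order F_1, F_2, ...
totalSize : ∀ {n} → (Fin n → Graph) → ℕ
totalSize {zero}  Φ = 0
totalSize {suc n} Φ = size (Φ zero) + totalSize (λ i → Φ (suc i))

decode : ∀ {n} (Φ : Fin n → Graph) → Fin (totalSize Φ) → Σ (Fin n) (λ i → Fin (size (Φ i)))
decode {suc n} Φ x with splitAt (size (Φ zero)) x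
... | inj₁ a = zero , a
... | inj₂ r with decode (λ i → Φ (suc i)) r
...   | i , b = suc i , b

module _ (G : Graph) (Φ : Fin (size G) → Graph) where

  lexAdj' : (p q : Σ (Fin (size G)) (λ i → Fin (size (Φ i)))) → Bool
  lexAdj' (i , a) (j , b) with i ≟ j
  ... | yes refl = adj (Φ i) a b
  ... | no _     = adj G i j

  lexAdj'-sym : ∀ p q → lexAdj' p q ≡ lexAdj' q p
  lexAdj'-sym (i , a) (j , b) with i ≟ j | j ≟ i
  ... | yes refl | yes refl = Graph.adjSym (Φ i) a b
  ... | yes refl | no ne    with ne refl
  ...   | ()
  lexAdj'-sym (i , a) (j , b) | no ne | yes refl with ne refl
  ...   | ()
  lexAdj'-sym (i , a) (j , b) | no _ | no _ = Graph.adjSym G i j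

  lexAdj'-irrefl : ∀ p → lexAdj' p p ≡ false
  lexAdj'-irrefl (i , a) with i ≟ i
  ... | yes refl = Graph.irrefl (Φ i) a
  ... | no ne with ne refl
  ...   | ()

  lexProduct : Graph
  lexProduct = record
    { size   = totalSize Φ
    ; adj    = λ x y → lexAdj' (decode Φ x) (decode Φ y)
    ; adjSym = λ x y → lexAdj'-sym (decode Φ x) (decode Φ y)
    ; irrefl = λ x → lexAdj'-irrefl (decode Φ x)
    }

-- If G is complete, two vertices of G[Φ] in different parts already form a minimal total
-- dominating set, and a minimal total dominating set lying inside one part F_i is, up to the
-- embedding, a minimal total dominating set of F_i; hence every minimal total dominating set of
-- G[Φ] has size 2 exactly when every minimal total dominating set of every F_i does.
-- If G is connected but not complete, it has an induced path u – w – v. A minimal total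
-- dominating set Y using only parts non-adjacent to u and v needs two vertices in each of the
-- parts of u and v; replacing these four by one vertex in each of the parts of u, v and w still
-- dominates, so G[Φ] has a minimal total dominating set smaller than Y.

module Submission where

open import Defs
open import Data.Bool using (true; false)
open import Data.Bool.Properties using () renaming (_≟_ to _≟ᵇ_)
open import Data.Empty using (⊥-elim)
open import Data.Fin using (Fin; zero; suc; fromℕ<; splitAt; _↑ˡ_; _↑ʳ_; _≟_)
open import Data.Fin.Properties using (any?; all?; splitAt-↑ˡ; splitAt-↑ʳ; splitAt⁻¹-↑ˡ; splitAt⁻¹-↑ʳ)
open import Data.Fin.Subset using (Subset; _∈_; _∉_; _⊆_; _⊂_; ∣_∣; ⁅_⁆; _∪_; _∩_; ⊥; ⊤; inside; outside)
open import Data.Fin.Subset.Induction using (Acc; acc; ⊂-wellFounded)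
open import Data.Fin.Subset.Properties
  using (_∈?_; _⊂?_; anySubset?; ∈⊤; ∉⊥; ⊥⊆; x∈⁅x⁆; x∈⁅y⁆⇒x≡y; ∣⁅x⁆∣≡1; ∣⊥∣≡0; ⊆-refl; ⊆-trans; p⊂q⇒p⊆q;
         p⊆q⇒∣p∣≤∣q∣; p⊂q⇒∣p∣<∣q∣; p⊆p∪q; q⊆p∪q; x∈p∪q⁻; x∈p∩q⁺; x∈p∩q⁻)
open import Data.Nat using (ℕ; zero; suc; _+_; _≤_; s≤s; z≤n)
open import Data.Nat.Properties using (≤-trans; ≤-antisym; n≮n; n≤1+n; +-suc; +-monoʳ-≤; +-comm)
open import Data.Product using (∃; ∃₂; _×_; _,_; proj₁; proj₂)
open import Data.Sum using (_⊎_; inj₁; inj₂)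
import Data.Sum as Sum
open import Data.Vec using (_∷_; []; tabulate)
open import Data.Vec.Properties using (lookup∘tabulate; []=⇒lookup; lookup⇒[]=)
open import Function using (_∘_)
open import Function.Bundles using (_⇔_; mk⇔)
open import Relation.Binary.PropositionalEquality using (_≡_; _≢_; refl; sym; trans; cong; subst)
open import Relation.Nullary using (¬_; Dec; yes; no; does)
open import Relation.Nullary.Decidable using (_×-dec_; ¬?; dec-true)
open import Relation.Unary using (Pred; Decidable)

private
  variable
    n : ℕ
    x y z : Fin n
    p q S : Subset n

subsetOf : ∀ {ℓ} {P : Pred (Fin n) ℓ} → Decidable P → Subset n
subsetOf P? = tabulate (does ∘ P?)

module _ {ℓ} {P : Pred (Fin n) ℓ} (P? : Decidable P) where

  ∈-subsetOf⁺ : P x → x ∈ subsetOf P?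
  ∈-subsetOf⁺ {x} px = lookup⇒[]= x _ (trans (lookup∘tabulate _ x) (dec-true (P? x) px))

  ∈-subsetOf⁻ : x ∈ subsetOf P? → P x
  ∈-subsetOf⁻ {x} x∈ with P? x | trans (sym (lookup∘tabulate (does ∘ P?) x)) ([]=⇒lookup x∈)
  ... | yes px | _ = px
  ... | no _   | ()

two-distinct : 2 ≤ n → ∃₂ λ (i j : Fin n) → i ≢ j
two-distinct (s≤s (s≤s _)) = zero , suc zero , λ ()

pair : Fin n → Fin n → Subset n
pair x y = ⁅ x ⁆ ∪ ⁅ y ⁆

x∈pair : x ∈ pair x y
x∈pair {x = x} {y} = p⊆p∪q ⁅ y ⁆ (x∈⁅x⁆ x)

y∈pair : y ∈ pair x y
y∈pair {y = y} {x} = q⊆p∪q ⁅ x ⁆ ⁅ y ⁆ (x∈⁅x⁆ y)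

∈pair⁻ : z ∈ pair x y → z ≡ x ⊎ z ≡ y
∈pair⁻ {x = x} {y} z∈ = Sum.map (x∈⁅y⁆⇒x≡y x) (x∈⁅y⁆⇒x≡y y) (x∈p∪q⁻ ⁅ x ⁆ ⁅ y ⁆ z∈)

pair⊆ : x ∈ S → y ∈ S → pair x y ⊆ S
pair⊆ x∈S y∈S z∈ with ∈pair⁻ z∈
... | inj₁ refl = x∈S
... | inj₂ refl = y∈S

x∈p∪⁅x⁆ : x ∈ p ∪ ⁅ x ⁆
x∈p∪⁅x⁆ {x = x} {p} = q⊆p∪q p ⁅ x ⁆ (x∈⁅x⁆ x)

∉-∪⁅⁆ : x ∉ p → x ≢ y → x ∉ p ∪ ⁅ y ⁆
∉-∪⁅⁆ {p = p} {y} x∉p x≢y x∈ with x∈p∪q⁻ p ⁅ y ⁆ x∈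
... | inj₁ x∈p = x∉p x∈p
... | inj₂ x∈y = x≢y (x∈⁅y⁆⇒x≡y y x∈y)

∣p∪q∣≤∣p∣+∣q∣ : (p q : Subset n) → ∣ p ∪ q ∣ ≤ ∣ p ∣ + ∣ q ∣
∣p∪q∣≤∣p∣+∣q∣ []             []             = z≤n
∣p∪q∣≤∣p∣+∣q∣ (inside ∷ p)  (inside ∷ q)  = s≤s (≤-trans (∣p∪q∣≤∣p∣+∣q∣ p q) (+-monoʳ-≤ ∣ p ∣ (n≤1+n ∣ q ∣)))
∣p∪q∣≤∣p∣+∣q∣ (inside ∷ p)  (outside ∷ q) = s≤s (∣p∪q∣≤∣p∣+∣q∣ p q)
∣p∪q∣≤∣p∣+∣q∣ (outside ∷ p) (inside ∷ q)  = subst (suc ∣ p ∪ q ∣ ≤_) (sym (+-suc ∣ p ∣ ∣ q ∣)) (s≤s (∣p∪q∣≤∣p∣+∣q∣ p q))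
∣p∪q∣≤∣p∣+∣q∣ (outside ∷ p) (outside ∷ q) = ∣p∪q∣≤∣p∣+∣q∣ p q

∣p∪⁅x⁆∣≤1+∣p∣ : (p : Subset n) (x : Fin n) → ∣ p ∪ ⁅ x ⁆ ∣ ≤ suc ∣ p ∣
∣p∪⁅x⁆∣≤1+∣p∣ p x = subst (∣ p ∪ ⁅ x ⁆ ∣ ≤_) (trans (cong (∣ p ∣ +_) (∣⁅x⁆∣≡1 x)) (+-comm ∣ p ∣ 1)) (∣p∪q∣≤∣p∣+∣q∣ p ⁅ x ⁆)

∣pair∣≤2 : (x y : Fin n) → ∣ pair x y ∣ ≤ 2
∣pair∣≤2 x y = subst (λ k → ∣ pair x y ∣ ≤ suc k) (∣⁅x⁆∣≡1 x) (∣p∪⁅x⁆∣≤1+∣p∣ ⁅ x ⁆ y)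

2+∣p∣≤∣q∣ : p ⊆ q → x ∈ q → y ∈ q → x ∉ p → y ∉ p → x ≢ y → 2 + ∣ p ∣ ≤ ∣ q ∣
2+∣p∣≤∣q∣ {p = p} {q} {x} {y} p⊆q x∈q y∈q x∉p y∉p x≢y =
  ≤-trans (s≤s (p⊂q⇒∣p∣<∣q∣ p⊂p∪x)) (≤-trans (p⊂q⇒∣p∣<∣q∣ p∪x⊂p∪x∪y) (p⊆q⇒∣p∣≤∣q∣ p∪x∪y⊆q))
  where
  p⊂p∪x : p ⊂ p ∪ ⁅ x ⁆
  p⊂p∪x = p⊆p∪q ⁅ x ⁆ , x , x∈p∪⁅x⁆ , x∉p

  p∪x⊂p∪x∪y : p ∪ ⁅ x ⁆ ⊂ (p ∪ ⁅ x ⁆) ∪ ⁅ y ⁆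
  p∪x⊂p∪x∪y = p⊆p∪q ⁅ y ⁆ , y , x∈p∪⁅x⁆ , ∉-∪⁅⁆ y∉p (λ y≡x → x≢y (sym y≡x))

  p∪x∪y⊆q : (p ∪ ⁅ x ⁆) ∪ ⁅ y ⁆ ⊆ q
  p∪x∪y⊆q z∈ with x∈p∪q⁻ (p ∪ ⁅ x ⁆) ⁅ y ⁆ z∈
  ... | inj₂ z∈y rewrite x∈⁅y⁆⇒x≡y y z∈y = y∈q
  ... | inj₁ z∈p∪x with x∈p∪q⁻ p ⁅ x ⁆ z∈p∪x
  ...   | inj₁ z∈p = p⊆q z∈p
  ...   | inj₂ z∈x rewrite x∈⁅y⁆⇒x≡y x z∈x = x∈q

Γt≤2 : Graph → Set
Γt≤2 H = ∀ S → IsMinimalTotalDominating H S → ∣ S ∣ ≤ 2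

module TotalDomination (H : Graph) where

  private
    TD  = IsTotalDominating H
    MTD = IsMinimalTotalDominating H
    V   = Fin (size H)

  tds? : (S : Subset (size H)) → Dec (TD S)
  tds? S = all? λ v → any? λ u → u ∈? S ×-dec adj H v u ≟ᵇ true

  tds-mono : p ⊆ q → TD p → TD q
  tds-mono p⊆q dom v with dom v
  ... | u , u∈p , vu = u , p⊆q u∈p , vu

  adj⇒≢ : adj H x y ≡ true → x ≢ y
  adj⇒≢ {x = x} xy refl with trans (sym xy) (irrefl H x)
  ... | ()

  minimal-⊆ : TD S → ∃ λ M → M ⊆ S × MTD M
  minimal-⊆ = descend (⊂-wellFounded _)
    where
    descend : Acc _⊂_ S → TD S → ∃ λ M → M ⊆ S × MTD M
    descend {S = S} (acc smaller) domS with anySubset? (λ T → T ⊂? S ×-dec tds? T)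
    ... | yes (T , T⊂S , domT) with descend (smaller T⊂S) domT
    ...   | M , M⊆T , minM = M , ⊆-trans M⊆T (p⊂q⇒p⊆q T⊂S) , minM
    descend {S = S} (acc _) domS | no none = S , ⊆-refl , domS , λ T T⊂S domT → none (T , T⊂S , domT)

  minimal⇒⊆ : MTD S → p ⊆ S → TD p → S ⊆ p
  minimal⇒⊆ {p = p} (_ , minimal) p⊆S domp {x} x∈S with x ∈? p
  ... | yes x∈p = x∈p
  ... | no x∉p  = ⊥-elim (minimal p (p⊆S , x , x∈S , x∉p) domp)

  edge-in-tds : V → TD S → ∃₂ λ x y → x ∈ S × y ∈ S × x ≢ y
  edge-in-tds v dom with dom v
  ... | x , x∈S , _ with dom x
  ...   | y , y∈S , xy = x , y , x∈S , y∈S , adj⇒≢ xy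

  2≤∣tds∣ : V → TD S → 2 ≤ ∣ S ∣
  2≤∣tds∣ {S = S} v dom with edge-in-tds v dom
  ... | x , y , x∈S , y∈S , x≢y =
    subst (λ k → 2 + k ≤ ∣ S ∣) (∣⊥∣≡0 (size H)) (2+∣p∣≤∣q∣ {p = ⊥} ⊥⊆ x∈S y∈S ∉⊥ ∉⊥ x≢y)

  small-tds-minimal : V → TD p → ∣ p ∣ ≤ 2 → MTD p
  small-tds-minimal v domp ∣p∣≤2 =
    domp , λ T T⊂p domT → n≮n 2 (≤-trans (≤-trans (s≤s (2≤∣tds∣ v domT)) (p⊂q⇒∣p∣<∣q∣ T⊂p)) ∣p∣≤2)

  small-tds⊆pair : V → TD S → ∣ S ∣ ≤ 2 → ∃₂ λ x y → x ∈ S × y ∈ S × S ⊆ pair x y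
  small-tds⊆pair {S = S} v dom ∣S∣≤2 with edge-in-tds v dom
  ... | x , y , x∈S , y∈S , x≢y = x , y , x∈S , y∈S , S⊆xy
    where
    S⊆xy : S ⊆ pair x y
    S⊆xy {z} z∈S with z ∈? pair x y
    ... | yes z∈xy = z∈xy
    ... | no z∉xy = ⊥-elim (n≮n 2 (≤-trans three≤∣S∣ ∣S∣≤2))
      where
      ∉⁅z⁆ : ∀ {w} → w ∈ pair x y → w ∉ ⁅ z ⁆
      ∉⁅z⁆ w∈xy w∈z rewrite x∈⁅y⁆⇒x≡y z w∈z = z∉xy w∈xy

      three≤∣S∣ : 3 ≤ ∣ S ∣
      three≤∣S∣ = subst (λ k → 2 + k ≤ ∣ S ∣) (∣⁅x⁆∣≡1 z)
        (2+∣p∣≤∣q∣ (pair⊆ z∈S z∈S ∘ p⊆p∪q ⁅ z ⁆) x∈S y∈S (∉⁅z⁆ x∈pair) (∉⁅z⁆ y∈pair) x≢y)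

  dominating-pair⇒∣minimal∣≤2 : MTD S → x ∈ S → y ∈ S → TD (pair x y) → ∣ S ∣ ≤ 2
  dominating-pair⇒∣minimal∣≤2 {x = x} {y} minS x∈S y∈S domxy =
    ≤-trans (p⊆q⇒∣p∣≤∣q∣ (minimal⇒⊆ minS (pair⊆ x∈S y∈S) domxy)) (∣pair∣≤2 x y)

  dominating-pair : V → Γt≤2 H → TD S → ∃₂ λ x y → x ∈ S × y ∈ S × TD (pair x y)
  dominating-pair v Γ≤2 dom with minimal-⊆ dom
  ... | M , M⊆S , minM with small-tds⊆pair v (proj₁ minM) (Γ≤2 M minM)
  ...   | x , y , x∈M , y∈M , M⊆xy = x , y , M⊆S x∈M , M⊆S y∈M , tds-mono M⊆xy (proj₁ minM)

  minimal-exists : (∀ v → ∃ λ u → adj H v u ≡ true) → ∃ MTD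
  minimal-exists nbr with minimal-⊆ {S = ⊤} (λ v → let u , vu = nbr v in u , ∈⊤ , vu)
  ... | M , _ , minM = M , minM

  wtd⇒∣minimal∣≤∣minimal∣ : WellTotalDominated H → MTD p → MTD q → ∣ p ∣ ≤ ∣ q ∣
  wtd⇒∣minimal∣≤∣minimal∣ (k , γ , Γ) minp minq = ≤-trans (proj₂ Γ _ minp) (proj₂ γ _ minq)

  γt-unique : ∀ {k m} → IsGammaT H k → IsGammaT H m → k ≡ m
  γt-unique ((S , minS , ∣S∣≡k) , k≤) ((T , minT , ∣T∣≡m) , m≤) =
    ≤-antisym (subst (_ ≤_) ∣T∣≡m (k≤ T minT)) (subst (_ ≤_) ∣S∣≡k (m≤ S minS))

  wtd⇒Γt≤2 : WellTotalDominated H → IsGammaT H 2 → Γt≤2 H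
  wtd⇒Γt≤2 (k , γk , Γk) γ2 S minS = subst (∣ S ∣ ≤_) (γt-unique γk γ2) (proj₂ Γk S minS)

  wtd-with-minimal-pair : WellTotalDominated H → MTD p → ∣ p ∣ ≡ 2 → IsGammaT H 2 × Γt≤2 H
  wtd-with-minimal-pair {p = p} (k , γk , Γk) minp ∣p∣≡2 = subst (IsGammaT H) k≡2 γk , λ S minS → subst (∣ S ∣ ≤_) k≡2 (proj₂ Γk S minS)
    where
    k≡2 : k ≡ 2
    k≡2 = trans (≤-antisym (proj₂ γk p minp) (proj₂ Γk p minp)) ∣p∣≡2

  Γt≤2⇒wtd : V → ∃ MTD → Γt≤2 H → WellTotalDominated H × IsGammaT H 2
  Γt≤2⇒wtd v (S , minS) Γ≤2 = (2 , γ2 , (S , minS , ∣S∣≡2) , Γ≤2) , γ2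
    where
    ∣S∣≡2 : ∣ S ∣ ≡ 2
    ∣S∣≡2 = ≤-antisym (Γ≤2 S minS) (2≤∣tds∣ v (proj₁ minS))

    γ2 : IsGammaT H 2
    γ2 = (S , minS , ∣S∣≡2) , λ T minT → 2≤∣tds∣ v (proj₁ minT)

record InducedP₃ (G : Graph) : Set where
  field
    u w v : Fin (size G)
    uw    : adj G u w ≡ true
    wv    : adj G w v ≡ true
    u≢v   : u ≢ v
    uv    : adj G u v ≡ false

module _ {G : Graph} where

  reach⇒InducedP₃ : ∀ {u v} → Reach G u v → u ≢ v → adj G u v ≡ false → InducedP₃ G
  reach⇒InducedP₃ here u≢v _ = ⊥-elim (u≢v refl)
  reach⇒InducedP₃ (step {u} {m} {v} um m⇝v) u≢v uv with m ≟ v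
  ... | yes refl with trans (sym um) uv
  ...   | ()
  reach⇒InducedP₃ (step {u} {m} {v} um m⇝v) u≢v uv | no m≢v with adj G m v in mv
  ...   | true  = record { u = u ; w = m ; v = v ; uw = um ; wv = mv ; u≢v = u≢v ; uv = uv }
  ...   | false = reach⇒InducedP₃ m⇝v m≢v mv

  connected-P₃-free⇒complete : Connected G → ¬ InducedP₃ G → Complete G
  connected-P₃-free⇒complete conn P₃-free u v u≢v with adj G u v in uv
  ... | true  = refl
  ... | false = ⊥-elim (P₃-free (reach⇒InducedP₃ (conn u v) u≢v uv))

embed : (Φ : Fin n → Graph) (i : Fin n) → Fin (size (Φ i)) → Fin (totalSize Φ)
embed {suc n} Φ zero    a = a ↑ˡ totalSize (Φ ∘ suc)
embed {suc n} Φ (suc i) a = size (Φ zero) ↑ʳ embed (Φ ∘ suc) i a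

decode-embed : (Φ : Fin n → Graph) (i : Fin n) (a : Fin (size (Φ i))) → decode Φ (embed Φ i a) ≡ (i , a)
decode-embed {suc n} Φ zero a rewrite splitAt-↑ˡ (size (Φ zero)) a (totalSize (Φ ∘ suc)) = refl
decode-embed {suc n} Φ (suc i) a
  rewrite splitAt-↑ʳ (size (Φ zero)) (totalSize (Φ ∘ suc)) (embed (Φ ∘ suc) i a)
        | decode-embed (Φ ∘ suc) i a = refl

embed-decode : (Φ : Fin n → Graph) (x : Fin (totalSize Φ)) → embed Φ (proj₁ (decode Φ x)) (proj₂ (decode Φ x)) ≡ x
embed-decode {suc n} Φ x with splitAt (size (Φ zero)) x in eq
... | inj₁ a = splitAt⁻¹-↑ˡ eq
... | inj₂ r with decode (Φ ∘ suc) r | embed-decode (Φ ∘ suc) r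
...   | i , b | embed≡r = trans (cong (size (Φ zero) ↑ʳ_) embed≡r) (splitAt⁻¹-↑ʳ eq)

module LexProduct (G : Graph) (Φ : Fin (size G) → Graph) (2≤∣G∣ : 2 ≤ size G)
                  (δ : ∀ i → MinDegreeAtLeast1 (Φ i)) where

  H : Graph
  H = lexProduct G Φ

  open TotalDomination H
  module Factor (i : Fin (size G)) = TotalDomination (Φ i)

  part : Fin (size H) → Fin (size G)
  part x = proj₁ (decode Φ x)

  ι : (i : Fin (size G)) → Fin (size (Φ i)) → Fin (size H)
  ι = embed Φ

  part-ι : ∀ i a → part (ι i a) ≡ i
  part-ι i a = cong proj₁ (decode-embed Φ i a)

  ι-injective : ∀ {i a b} → ι i a ≡ ι i b → a ≡ b
  ι-injective {i} {a} {b} eq with trans (sym (decode-embed Φ i a)) (trans (cong (decode Φ) eq) (decode-embed Φ i b))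
  ... | refl = refl

  part≡⇒ι : ∀ {x i} → part x ≡ i → ∃ λ a → x ≡ ι i a
  part≡⇒ι {x} refl = proj₂ (decode Φ x) , sym (embed-decode Φ x)

  adj-ι : ∀ i a b → adj H (ι i a) (ι i b) ≡ adj (Φ i) a b
  adj-ι i a b rewrite decode-embed Φ i a | decode-embed Φ i b with i ≟ i
  ... | yes refl = refl
  ... | no i≢i   = ⊥-elim (i≢i refl)

  adj-part-≢ : part x ≢ part y → adj H x y ≡ adj G (part x) (part y)
  adj-part-≢ {x = x} {y} = lexAdj-≢ (decode Φ x) (decode Φ y)
    where
    lexAdj-≢ : ∀ p q → proj₁ p ≢ proj₁ q → lexAdj' G Φ p q ≡ adj G (proj₁ p) (proj₁ q)
    lexAdj-≢ (i , a) (j , b) i≢j with i ≟ j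
    ... | yes refl = ⊥-elim (i≢j refl)
    ... | no _     = refl

  adj⇒part : adj H x y ≡ true → part x ≡ part y ⊎ adj G (part x) (part y) ≡ true
  adj⇒part {x = x} {y} xy = by-cases (part x ≟ part y)
    where
    by-cases : Dec (part x ≡ part y) → part x ≡ part y ⊎ adj G (part x) (part y) ≡ true
    by-cases (yes same) = inj₁ same
    by-cases (no other) = inj₂ (trans (sym (adj-part-≢ other)) xy)

  adj-toward-part : ∀ z i a → adj G (part z) i ≡ true → adj H z (ι i a) ≡ true
  adj-toward-part z i a zi = trans (adj-part-≢ z≢ia) (trans (cong (adj G (part z)) (part-ι i a)) zi)
    where
    z≢ia : part z ≢ part (ι i a)
    z≢ia eq = TotalDomination.adj⇒≢ G zi (trans eq (part-ι i a))

  point : ∀ i → Fin (size (Φ i))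
  point i = fromℕ< (proj₁ (δ i))

  vertex : Fin (size H)
  vertex = ι i (point i)
    where
    i = proj₁ (two-distinct 2≤∣G∣)

  neighbour-in-part : ∀ z → ∃ λ y → part y ≡ part z × adj H z y ≡ true
  neighbour-in-part z with proj₂ (δ (part z)) (proj₂ (decode Φ z))
  ... | b , ab = ι (part z) b , part-ι (part z) b ,
                 subst (λ z′ → adj H z′ (ι (part z) b) ≡ true) (embed-decode Φ z) (trans (adj-ι (part z) _ b) ab)

  image : ∀ i → Subset (size (Φ i)) → Subset (size H)
  image i T = subsetOf (λ x → any? λ a → a ∈? T ×-dec ι i a ≟ x)

  ∈-image⁺ : ∀ {i T a} → a ∈ T → ι i a ∈ image i T
  ∈-image⁺ {i} {T} {a} a∈T = ∈-subsetOf⁺ (λ x → any? λ a → a ∈? T ×-dec ι i a ≟ x) (a , a∈T , refl)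

  ∈-image⁻ : ∀ {i T x} → x ∈ image i T → ∃ λ a → a ∈ T × ι i a ≡ x
  ∈-image⁻ {i} {T} = ∈-subsetOf⁻ (λ x → any? λ a → a ∈? T ×-dec ι i a ≟ x)

  preimage : ∀ i → Subset (size H) → Subset (size (Φ i))
  preimage i S = subsetOf (λ a → ι i a ∈? S)

  ∈-preimage⁺ : ∀ {i S a} → ι i a ∈ S → a ∈ preimage i S
  ∈-preimage⁺ {i} {S} = ∈-subsetOf⁺ (λ a → ι i a ∈? S)

  ∈-preimage⁻ : ∀ {i S a} → a ∈ preimage i S → ι i a ∈ S
  ∈-preimage⁻ {i} {S} = ∈-subsetOf⁻ (λ a → ι i a ∈? S)

  preimage-tds : ∀ {i S} → IsTotalDominating H S → (∀ {s} → s ∈ S → part s ≡ i) →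
                 IsTotalDominating (Φ i) (preimage i S)
  preimage-tds {i} domS inPart c with domS (ι i c)
  ... | s , s∈S , cs with part≡⇒ι (inPart s∈S)
  ...   | a , refl = a , ∈-preimage⁺ s∈S , trans (sym (adj-ι i c a)) cs

  lower-pair : ∀ {i a b} → IsTotalDominating H (pair (ι i a) (ι i b)) → IsTotalDominating (Φ i) (pair a b)
  lower-pair {i} {a} {b} dom = Factor.tds-mono i preimage⊆pair (preimage-tds dom inPart)
    where
    inPart : ∀ {s} → s ∈ pair (ι i a) (ι i b) → part s ≡ i
    inPart s∈ with ∈pair⁻ s∈
    ... | inj₁ refl = part-ι i a
    ... | inj₂ refl = part-ι i b

    preimage⊆pair : preimage i (pair (ι i a) (ι i b)) ⊆ pair a b
    preimage⊆pair c∈ with ∈pair⁻ (∈-preimage⁻ c∈)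
    ... | inj₁ eq rewrite ι-injective eq = x∈pair
    ... | inj₂ eq rewrite ι-injective eq = y∈pair

  module _ (complete : Complete G) where

    adj-across : part x ≢ part y → adj H x y ≡ true
    adj-across other = trans (adj-part-≢ other) (complete _ _ other)

    pair-across-tds : part x ≢ part y → IsTotalDominating H (pair x y)
    pair-across-tds {x = x} {y} x≁y z with part z ≟ part x
    ... | yes same = y , y∈pair , adj-across (λ zy → x≁y (trans (sym same) zy))
    ... | no other = x , x∈pair , adj-across other

    image-tds : ∀ {i T} → IsTotalDominating (Φ i) T → IsTotalDominating H (image i T)
    image-tds {i} domT z with part z ≟ i
    ... | yes same with part≡⇒ι same
    ...   | c , refl with domT c
    ...     | a , a∈T , ca = ι i a , ∈-image⁺ a∈T , trans (adj-ι i c a) ca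
    image-tds {i} domT z | no other with domT (point i)
    ... | a , a∈T , _ = ι i a , ∈-image⁺ a∈T , adj-across (λ eq → other (trans eq (part-ι i a)))

    lift-pair : ∀ {i a b} → IsTotalDominating (Φ i) (pair a b) → IsTotalDominating H (pair (ι i a) (ι i b))
    lift-pair {i} {a} {b} dom = tds-mono image⊆pair (image-tds dom)
      where
      image⊆pair : image i (pair a b) ⊆ pair (ι i a) (ι i b)
      image⊆pair x∈ with ∈-image⁻ x∈
      ... | c , c∈ab , refl with ∈pair⁻ c∈ab
      ...   | inj₁ refl = x∈pair
      ...   | inj₂ refl = y∈pair

    minimal-pair : ∃ λ P → IsMinimalTotalDominating H P × ∣ P ∣ ≡ 2
    minimal-pair with two-distinct 2≤∣G∣
    ... | i , j , i≢j = pair x₀ y₀ , small-tds-minimal x₀ dom (∣pair∣≤2 x₀ y₀) ,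
                        ≤-antisym (∣pair∣≤2 x₀ y₀) (2≤∣tds∣ x₀ dom)
      where
      x₀ = ι i (point i)
      y₀ = ι j (point j)

      dom : IsTotalDominating H (pair x₀ y₀)
      dom = pair-across-tds (λ eq → i≢j (trans (sym (part-ι i _)) (trans eq (part-ι j _))))

    Γt≤2-factor : Γt≤2 H → ∀ i → Γt≤2 (Φ i)
    Γt≤2-factor Γ≤2 i T minT with dominating-pair vertex Γ≤2 (image-tds (proj₁ minT))
    ... | x , y , x∈ , y∈ , domxy with ∈-image⁻ x∈ | ∈-image⁻ y∈
    ...   | a , a∈T , refl | b , b∈T , refl =
      Factor.dominating-pair⇒∣minimal∣≤2 i minT a∈T b∈T (lower-pair domxy)

    Γt≤2-within-part : ∀ {i S} → Γt≤2 (Φ i) → IsMinimalTotalDominating H S → (∀ {s} → s ∈ S → part s ≡ i) → ∣ S ∣ ≤ 2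
    Γt≤2-within-part {i} Γ≤2 minS inPart with Factor.dominating-pair i (point i) Γ≤2 (preimage-tds (proj₁ minS) inPart)
    ... | a , b , a∈ , b∈ , domab =
      dominating-pair⇒∣minimal∣≤2 minS (∈-preimage⁻ a∈) (∈-preimage⁻ b∈) (lift-pair domab)

    Γt≤2-product : (∀ i → Γt≤2 (Φ i)) → Γt≤2 H
    Γt≤2-product Γ≤2 S minS with any? (λ x → any? λ y → x ∈? S ×-dec y ∈? S ×-dec ¬? (part x ≟ part y))
    ... | yes (x , y , x∈S , y∈S , x≁y) = dominating-pair⇒∣minimal∣≤2 minS x∈S y∈S (pair-across-tds x≁y)
    ... | no one-part with proj₁ minS vertex
    ...   | s , s∈S , _ = Γt≤2-within-part (Γ≤2 (part s)) minS inPart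
      where
      inPart : ∀ {t} → t ∈ S → part t ≡ part s
      inPart {t} t∈S with part t ≟ part s
      ... | yes same = same
      ... | no other = ⊥-elim (one-part (t , s , t∈S , s∈S , other))

  confined : ∀ {z y i} → adj H z y ≡ true → part z ≡ i → adj G (part y) i ≡ false → part y ≡ i
  confined zy refl y≁z with adj⇒part zy
  ... | inj₁ same = sym same
  ... | inj₂ z∼y with trans (sym z∼y) (trans (adjSym G _ _) y≁z)
  ...   | ()

  escapes : ∀ {z y i} → adj H z y ≡ true → part z ≢ i → adj G (part z) i ≡ false → part y ≢ i
  escapes {z} {y} zy z≢i z≁i y≡i = z≢i (confined (trans (adjSym H y z) zy) y≡i z≁i)

  twice-in-part : ∀ {Y} i → IsTotalDominating H Y → (∀ {y} → y ∈ Y → adj G (part y) i ≡ false) →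
                  ∃₂ λ y y′ → y ∈ Y × y′ ∈ Y × y ≢ y′ × part y ≡ i × part y′ ≡ i
  twice-in-part i domY far with domY (ι i (point i))
  ... | y , y∈Y , xy with domY y
  ...   | y′ , y′∈Y , yy′ = y , y′ , y∈Y , y′∈Y , adj⇒≢ yy′ , y∈i , confined yy′ y∈i (far y′∈Y)
    where
    y∈i = confined xy (part-ι i (point i)) (far y∈Y)

  far? : ∀ i → Decidable (λ x → adj G (part x) i ≡ false)
  far? i x = adj G (part x) i ≟ᵇ false

  away? : ∀ i → Decidable (λ x → part x ≢ i)
  away? i x = ¬? (part x ≟ i)

  module InducedP₃-obstruction (path : InducedP₃ G) where
    open InducedP₃ path

    Y₀ : Subset (size H)
    Y₀ = subsetOf (far? u) ∩ subsetOf (far? v)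

    ∈Y₀⁺ : ∀ {x} → adj G (part x) u ≡ false → adj G (part x) v ≡ false → x ∈ Y₀
    ∈Y₀⁺ x≁u x≁v = x∈p∩q⁺ (∈-subsetOf⁺ (far? u) x≁u , ∈-subsetOf⁺ (far? v) x≁v)

    ι∈Y₀ : ∀ {i} a → adj G i u ≡ false → adj G i v ≡ false → ι i a ∈ Y₀
    ι∈Y₀ {i} a i≁u i≁v = ∈Y₀⁺ (at-part i≁u) (at-part i≁v)
      where
      at-part : ∀ {j} → adj G i j ≡ false → adj G (part (ι i a)) j ≡ false
      at-part = subst (λ k → adj G k _ ≡ false) (sym (part-ι i a))

    Y₀-tds : IsTotalDominating H Y₀
    Y₀-tds z with adj G (part z) u in z∼u
    ... | true = ι u (point u) , ι∈Y₀ (point u) (irrefl G u) uv , adj-toward-part z u _ z∼u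
    ... | false with adj G (part z) v in z∼v
    ...   | true  = ι v (point v) , ι∈Y₀ (point v) (trans (adjSym G v u) uv) (irrefl G v) , adj-toward-part z v _ z∼v
    ...   | false with neighbour-in-part z
    ...     | y , y∈z , zy = y , ∈Y₀⁺ (subst (λ i → adj G i u ≡ false) (sym y∈z) z∼u)
                                    (subst (λ i → adj G i v ≡ false) (sym y∈z) z∼v) , zy

    Y : Subset (size H)
    Y = proj₁ (minimal-⊆ Y₀-tds)

    Y⊆Y₀ : Y ⊆ Y₀
    Y⊆Y₀ = proj₁ (proj₂ (minimal-⊆ Y₀-tds))

    minY : IsMinimalTotalDominating H Y
    minY = proj₂ (proj₂ (minimal-⊆ Y₀-tds))

    domY : IsTotalDominating H Y
    domY = proj₁ minY

    far-u : ∀ {y} → y ∈ Y → adj G (part y) u ≡ false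
    far-u y∈Y = ∈-subsetOf⁻ (far? u) (proj₁ (x∈p∩q⁻ _ _ (Y⊆Y₀ y∈Y)))

    far-v : ∀ {y} → y ∈ Y → adj G (part y) v ≡ false
    far-v y∈Y = ∈-subsetOf⁻ (far? v) (proj₂ (x∈p∩q⁻ _ _ (Y⊆Y₀ y∈Y)))

    Yᵤ Q : Subset (size H)
    Yᵤ = Y ∩ subsetOf (away? u)
    Q  = Yᵤ ∩ subsetOf (away? v)

    ∈Q⁺ : ∀ {y} → y ∈ Y → part y ≢ u → part y ≢ v → y ∈ Q
    ∈Q⁺ y∈Y y≢u y≢v = x∈p∩q⁺ (x∈p∩q⁺ (y∈Y , ∈-subsetOf⁺ (away? u) y≢u) , ∈-subsetOf⁺ (away? v) y≢v)

    4+∣Q∣≤∣Y∣ : 4 + ∣ Q ∣ ≤ ∣ Y ∣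
    4+∣Q∣≤∣Y∣ with twice-in-part u domY far-u | twice-in-part v domY far-v
    ... | y₁ , y₂ , y₁∈ , y₂∈ , y₁≢y₂ , y₁∈u , y₂∈u | y₃ , y₄ , y₃∈ , y₄∈ , y₃≢y₄ , y₃∈v , y₄∈v =
      ≤-trans (s≤s (s≤s (2+∣p∣≤∣q∣ Q⊆Yᵤ (∈Yᵤ y₃∈ y₃∈v) (∈Yᵤ y₄∈ y₄∈v) (∉Q y₃∈v) (∉Q y₄∈v) y₃≢y₄)))
              (2+∣p∣≤∣q∣ Yᵤ⊆Y y₁∈ y₂∈ (∉Yᵤ y₁∈u) (∉Yᵤ y₂∈u) y₁≢y₂)
      where
      Q⊆Yᵤ : Q ⊆ Yᵤ
      Q⊆Yᵤ = proj₁ ∘ x∈p∩q⁻ _ _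

      Yᵤ⊆Y : Yᵤ ⊆ Y
      Yᵤ⊆Y = proj₁ ∘ x∈p∩q⁻ _ _

      ∈Yᵤ : ∀ {y} → y ∈ Y → part y ≡ v → y ∈ Yᵤ
      ∈Yᵤ y∈Y refl = x∈p∩q⁺ (y∈Y , ∈-subsetOf⁺ (away? u) (λ v≡u → u≢v (sym v≡u)))

      ∉Yᵤ : ∀ {y} → part y ≡ u → y ∉ Yᵤ
      ∉Yᵤ y∈u y∈Yᵤ = ∈-subsetOf⁻ (away? u) (proj₂ (x∈p∩q⁻ _ _ y∈Yᵤ)) y∈u

      ∉Q : ∀ {y} → part y ≡ v → y ∉ Q
      ∉Q y∈v y∈Q = ∈-subsetOf⁻ (away? v) (proj₂ (x∈p∩q⁻ _ _ y∈Q)) y∈v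

    xu xv xw : Fin (size H)
    xu = ι u (point u)
    xv = ι v (point v)
    xw = ι w (point w)

    X : Subset (size H)
    X = ((Q ∪ ⁅ xu ⁆) ∪ ⁅ xv ⁆) ∪ ⁅ xw ⁆

    ∣X∣≤3+∣Q∣ : ∣ X ∣ ≤ 3 + ∣ Q ∣
    ∣X∣≤3+∣Q∣ = ≤-trans (∣p∪⁅x⁆∣≤1+∣p∣ ((Q ∪ ⁅ xu ⁆) ∪ ⁅ xv ⁆) xw)
                 (s≤s (≤-trans (∣p∪⁅x⁆∣≤1+∣p∣ (Q ∪ ⁅ xu ⁆) xv) (s≤s (∣p∪⁅x⁆∣≤1+∣p∣ Q xu))))

    X-tds : IsTotalDominating H X
    X-tds z with part z ≟ u | part z ≟ v
    ... | yes refl | _ = xw , x∈p∪⁅x⁆ , adj-toward-part z w _ uw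
    ... | no _ | yes refl = xw , x∈p∪⁅x⁆ , adj-toward-part z w _ (trans (adjSym G v w) wv)
    ... | no z≢u | no z≢v with adj G (part z) u in z∼u | adj G (part z) v in z∼v
    ...   | true | _ = xu , p⊆p∪q _ (p⊆p∪q _ x∈p∪⁅x⁆) , adj-toward-part z u _ z∼u
    ...   | false | true = xv , p⊆p∪q _ x∈p∪⁅x⁆ , adj-toward-part z v _ z∼v
    ...   | false | false with domY z
    ...     | y , y∈Y , zy = y , p⊆p∪q _ (p⊆p∪q _ (p⊆p∪q _ (∈Q⁺ y∈Y (escapes zy z≢u z∼u) (escapes zy z≢v z∼v)))) , zy

    not-well-dominated : ¬ WellTotalDominated H
    not-well-dominated wtd =
      let M , M⊆X , minM = minimal-⊆ X-tds
      in n≮n (3 + ∣ Q ∣) (≤-trans 4+∣Q∣≤∣Y∣ (≤-trans (wtd⇒∣minimal∣≤∣minimal∣ wtd minY minM)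
                                            (≤-trans (p⊆q⇒∣p∣≤∣q∣ M⊆X) ∣X∣≤3+∣Q∣)))

theorem3p9 : (G : Graph) → 2 ≤ size G → Connected G →
    (Φ : Fin (size G) → Graph) → (∀ i → MinDegreeAtLeast1 (Φ i)) →
    (WellTotalDominated (lexProduct G Φ) ⇔
      (Complete G × (∀ i → WellTotalDominated (Φ i) × IsGammaT (Φ i) 2)))
    × (WellTotalDominated (lexProduct G Φ) → IsGammaT (lexProduct G Φ) 2)
theorem3p9 G 2≤∣G∣ connected Φ δ = mk⇔ (λ wtd → complete wtd , factors wtd) product , proj₁ ∘ bounds
  where
  open LexProduct G Φ 2≤∣G∣ δ
  open TotalDomination H using (wtd-with-minimal-pair; Γt≤2⇒wtd)

  complete : WellTotalDominated H → Complete G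
  complete wtd = connected-P₃-free⇒complete connected (λ path → InducedP₃-obstruction.not-well-dominated path wtd)

  bounds : WellTotalDominated H → IsGammaT H 2 × Γt≤2 H
  bounds wtd = let P , minP , ∣P∣≡2 = minimal-pair (complete wtd) in wtd-with-minimal-pair wtd minP ∣P∣≡2

  factors : WellTotalDominated H → ∀ i → WellTotalDominated (Φ i) × IsGammaT (Φ i) 2
  factors wtd i = Factor.Γt≤2⇒wtd i (point i) (Factor.minimal-exists i (proj₂ (δ i)))
                    (Γt≤2-factor (complete wtd) (proj₂ (bounds wtd)) i)

  product : Complete G × (∀ i → WellTotalDominated (Φ i) × IsGammaT (Φ i) 2) → WellTotalDominated H
  product (cpl , wtdΦ) =
    let P , minP , _ = minimal-pair cpl
    in proj₁ (Γt≤2⇒wtd vertex (P , minP) (Γt≤2-product cpl λ i → Factor.wtd⇒Γt≤2 i (proj₁ (wtdΦ i)) (proj₂ (wtdΦ i))))
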